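{- Work in Church's typed intensional language expanded by representation function symbols, in any structure satisfying Typed Sense Determines Reference, the Representation Axiom, and the Characterization of Intensional Application (all stated in the context). Then for all types $a,b$ and every $f$ of type $ab$: $f$ is injective (i.e. $\forall x,y$ of type $a$, $f(x)=f(y)\rightarrow x=y$) if and only if for every $f'$ of type $(ab)'$ with $\Delta_{ab}(f')=f$ and all $x',y'$ of type $a'$, if $f'\langle x'\rangle$ and $f'\langle y'\rangle$ are defined and $f'\langle x'\rangle=f'\langle y'\rangle$, then $\Delta_a(x')=\Delta_a(y')$.
   Context: Types: $e,t$ are types; if $a,b$ are types so are $ab$ (functions from type $a$ to type $b$) and $a'$ (senses presenting type-$a$ entities), $a\mapsto a'$ primitive. The language is many-sorted with one sort per type, extensional application $f(x)$ (types $ab,a\mapsto b$), a binary relation $\Delta_a$ between types $a'$ and $a$ written $\Delta_a(f')=f$ ($\Delta_a(f')$ is "defined" if some such $f$ exists), a ternary intensional-application relation between types $(ab)',a',b'$ written $f'\langle x'\rangle=y'$ ("defined" if some such $y'$ exists), untyped identity, and for each type $a$ a function symbol $\nabla_a$ from type $a$ to type $a'$. Axioms: Typed Sense Determines Reference: $\Delta_a(f')=d_0\wedge\Delta_a(f')=d_1\rightarrow d_0=d_1$. Representation Axiom: for every $f$ of type $a$, $\Delta_a(\nabla_a(f))=f$. Characterization of Intensional Application: for $f'$ of type $(ab)'$ and $x'$ of type $a'$, $f'\langle x'\rangle$ is defined exactly when $\Delta_{ab}(f')$ and $\Delta_a(x')$ are defined, and then $f'\langle x'\rangle$ is unique and equals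 $\nabla_b\big((\Delta_{ab}(f'))(\Delta_a(x'))\big)$. -}

module Defs where

open import Level using (Level; suc; _⊔_)
open import Data.Product using (Σ; ∃; _×_; _,_)
open import Relation.Binary.PropositionalEquality using (_≡_)

data Ty : Set where
  e   : Ty
  t   : Ty
  _⇒_ : Ty → Ty → Ty
  _′  : Ty → Ty

infixr 20 _⇒_
infix 30 _′

-- A structure for the many-sorted language (with representation symbols ∇),
-- satisfying the three axioms from the context.
-- Identity is interpreted as real identity (≡) in each sort.
record Structure (ℓ ℓ' : Level) : Set (suc (ℓ ⊔ ℓ')) where
  field
    D     : Ty → Set ℓ
    app   : ∀ {a b} → D (a ⇒ b) → D a → D b
    -- Δ_a(f') = f : binary relation between types a' and a
    Δ     : ∀ a → D (a ′) → D a → Set ℓ'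
    -- f'⟨x'⟩ = y' : ternary relation between types (ab)', a', b'
    iapp  : ∀ {a b} → D ((a ⇒ b) ′) → D (a ′) → D (b ′) → Set ℓ'
    ∇     : ∀ a → D a → D (a ′)

    sdr   : ∀ a (f' : D (a ′)) (d₀ d₁ : D a) → Δ a f' d₀ → Δ a f' d₁ → d₀ ≡ d₁
    rep   : ∀ a (f : D a) → Δ a (∇ a f) f
    -- Characterization of Intensional Application:
    -- f'⟨x'⟩ defined iff Δ_{ab}(f'), Δ_a(x') defined ...
    iapp-defined : ∀ a b (f' : D ((a ⇒ b) ′)) (x' : D (a ′)) →
      (∃ λ y' → iapp f' x' y') →
      (∃ λ f → Δ (a ⇒ b) f' f) × (∃ λ x → Δ a x' x)
    -- ... and then f'⟨x'⟩ = ∇_b((Δ_{ab} f')(Δ_a x')) (this also gives uniqueness)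
    iapp-char : ∀ a b (f' : D ((a ⇒ b) ′)) (x' : D (a ′)) (f : D (a ⇒ b)) (x : D a) →
      Δ (a ⇒ b) f' f → Δ a x' x →
      ∀ y' → (iapp f' x' y' → y' ≡ ∇ b (app f x)) × (y' ≡ ∇ b (app f x) → iapp f' x' y')
    -- (the "if defined" direction is the second component at y' = ∇_b(f(x)))

  -- Δ_a(x') = Δ_a(y') : both defined and equal (Church/Anderson identity between
  -- Δ-terms, i.e. ∃ d. Δ_a(x')=d ∧ Δ_a(y')=d)
  SameRef : ∀ a → D (a ′) → D (a ′) → Set (ℓ ⊔ ℓ')
  SameRef a x' y' = ∃ λ d → Δ a x' d × Δ a y' d

  Injective : ∀ {a b} → D (a ⇒ b) → Set ℓ
  Injective {a} f = ∀ (x y : D a) → app f x ≡ app f y → x ≡ y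

  IntInjective : ∀ a b → D (a ⇒ b) → Set (ℓ ⊔ ℓ')
  IntInjective a b f = ∀ (f' : D ((a ⇒ b) ′)) → Δ (a ⇒ b) f' f →
    ∀ (x' y' : D (a ′)) →
    ∀ (u' v' : D (b ′)) → iapp f' x' u' → iapp f' y' v' → u' ≡ v' →
    SameRef a x' y'

-- Representations ∇ are injective, since a sense determines its reference and
-- ∇ x presents x. Hence f'⟨x'⟩ = ∇ (f x) turns equality of intensional values into
-- equality of extensional ones, giving the forward direction; conversely, applying
-- the intensional condition to the canonical senses ∇ f, ∇ x, ∇ y recovers x = y.
module Submission where

open import Defs
open import Data.Product using (_×_; _,_; proj₁; proj₂)
open import Relation.Binary.PropositionalEquality using (_≡_; refl; sym; trans; cong; subst)

module _ {ℓ ℓ'} (S : Structure ℓ ℓ') where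
  open Structure S

  Δ-∇-unique : ∀ a (x y : D a) → Δ a (∇ a x) y → x ≡ y
  Δ-∇-unique a x y Δy = sdr a (∇ a x) x y (rep a x) Δy

  ∇-injective : ∀ a (x y : D a) → ∇ a x ≡ ∇ a y → x ≡ y
  ∇-injective a x y ∇x≡∇y = Δ-∇-unique a x y (subst (λ z → Δ a z y) (sym ∇x≡∇y) (rep a y))

  iapp-value : ∀ {a b} {f' x' u'} {f : D (a ⇒ b)} {x : D a} →
    Δ (a ⇒ b) f' f → Δ a x' x → iapp f' x' u' → u' ≡ ∇ b (app f x)
  iapp-value {a} {b} {f'} {x'} {u'} {f} {x} Δf Δx = proj₁ (iapp-char a b f' x' f x Δf Δx u')

  iapp-∇ : ∀ {a b} (f : D (a ⇒ b)) (x : D a) → iapp (∇ (a ⇒ b) f) (∇ a x) (∇ b (app f x))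
  iapp-∇ {a} {b} f x = proj₂ (iapp-char a b _ _ f x (rep _ f) (rep a x) _) refl

  injective⇒intInjective : ∀ {a b} (f : D (a ⇒ b)) → Injective f → IntInjective a b f
  injective⇒intInjective {a} {b} f inj f' Δf x' y' u' v' fx' fy' u'≡v'
    with iapp-defined a b f' x' (u' , fx') | iapp-defined a b f' y' (v' , fy')
  ... | _ , x , Δx | _ , y , Δy = x , Δx , subst (Δ a y') (sym x≡y) Δy
    where
    fx≡fy : app f x ≡ app f y
    fx≡fy = ∇-injective b _ _
      (trans (sym (iapp-value Δf Δx fx')) (trans u'≡v' (iapp-value Δf Δy fy')))
    x≡y : x ≡ y
    x≡y = inj x y fx≡fy

  intInjective⇒injective : ∀ {a b} (f : D (a ⇒ b)) → IntInjective a b f → Injective f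
  intInjective⇒injective {a} {b} f intInj x y fx≡fy
    with intInj (∇ _ f) (rep _ f) (∇ a x) (∇ a y) _ _ (iapp-∇ f x) (iapp-∇ f y) (cong (∇ b) fx≡fy)
  ... | d , Δx , Δy = trans (Δ-∇-unique a x d Δx) (sym (Δ-∇-unique a y d Δy))

mainTheorem7 : ∀ {ℓ ℓ'} (S : Structure ℓ ℓ') → ∀ a b (f : Structure.D S (a ⇒ b)) →
    (Structure.Injective S f → Structure.IntInjective S a b f) ×
    (Structure.IntInjective S a b f → Structure.Injective S f)
mainTheorem7 S a b f = injective⇒intInjective S f , intInjective⇒injective S f
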